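{- Let $n\ge1$. Let $\mathcal K_n$ be the matrix indexed by compositions of $n$ with $(\mathcal K_n)_{IJ}=\prod_{d\in\mathrm{Des}(J)}y_d(I)$, and let $\mathcal K'_n$ be its image under the specialization sending $y_w\mapsto1$ for every word $w$ ending with $1$ (and leaving the $y_w$ with $w$ ending in $0$ unchanged). Then $S_n=\mathcal K_n{\mathcal K'_n}^{ -1}$ is lower triangular (rows and columns indexed by compositions in reverse lexicographic order, i.e. boolean words in lexicographic order), and its entry indexed by $(I,J)$ is $$s_{IJ}=\prod_{k=1}^{n-1}\frac{y_k(I)-y'^k(J)}{y'_k(J)-y'^k(J)},$$ where $y'_k(J)$ and $y'^k(J)$ are the images of $y_k(J)$ and $y^k(J)$ under the specialization.
   Context: $\{y_w\}$ are commuting indeterminates indexed by nonempty boolean words of length at most $n-1$. A composition $I$ of $n$ with descent set $\mathrm{Des}(I)=\{i_1,i_1+i_2,\dots\}\subseteq\{1,\dots,n-1\}$ is encoded by the boolean word $u_1\cdots u_{n-1}$ with $u_k=1$ iff $k\in\mathrm{Des}(I)$; $y_k(I)=y_{u_1\cdots u_k}$ and $y^k(I)=y_{u_1\cdots u_{k-1}(1-u_k)}$. ($\mathcal K_n$ is the Kostka matrix of the basis $P_I=\sum_J(\mathcal K_n)_{IJ}R_J$ of noncommutative symmetric functions, $R_J$ the ribbon basis.) -}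

module Defs where

open import Level using (_⊔_)
open import Data.Bool using (Bool; true; false; not; if_then_else_)
open import Data.Nat using (ℕ; zero; suc)
open import Data.Fin using (Fin; toℕ)
import Data.Fin as Fin
open import Data.List using (List; []; _∷_; _++_; take; map; foldr; [_])
open import Data.Vec using (Vec; toList; lookup)
import Data.Vec as Vec
import Data.Vec.Properties as VecP
import Data.Bool.Properties as BoolP
open import Data.Product using (_×_)
open import Relation.Nullary using (does)
open import Algebra.Bundles using (CommutativeRing)

-- Boolean words indexing the indeterminates y_w (only nonempty words of
-- length ≤ n-1 are ever used).
Word : Set
Word = List Bool

endsIn1 : Word → Bool
endsIn1 []           = false
endsIn1 (b ∷ [])     = b
endsIn1 (_ ∷ b ∷ w)  = endsIn1 (b ∷ w)

-- A composition I of n is encoded by its boolean word u = u_1 ⋯ u_{n-1}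
-- (an element of Vec Bool (n-1)); positions k ∈ {1,…,n-1} are Fin (n-1),
-- with Fin index k standing for position toℕ k + 1.

-- u_1 ⋯ u_k   (the word indexing y_k(I))
prefixW : ∀ {m} → Vec Bool m → Fin m → Word
prefixW u k = take (suc (toℕ k)) (toList u)

-- u_1 ⋯ u_{k-1} (1 - u_k)   (the word indexing y^k(I))
flipW : ∀ {m} → Vec Bool m → Fin m → Word
flipW u k = take (toℕ k) (toList u) ++ [ not (lookup u k) ]

allWords : (m : ℕ) → List (Vec Bool m)
allWords zero    = Vec.[] ∷ []
allWords (suc m) = map (false Vec.∷_) (allWords m) ++ map (true Vec.∷_) (allWords m)

data _<ₗ_ : ∀ {m} → Vec Bool m → Vec Bool m → Set where
  here  : ∀ {m} {u v : Vec Bool m} → (false Vec.∷ u) <ₗ (true Vec.∷ v)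
  there : ∀ {m} {b} {u v : Vec Bool m} → u <ₗ v → (b Vec.∷ u) <ₗ (b Vec.∷ v)

module _ {c ℓ} (R : CommutativeRing c ℓ) where
  open CommutativeRing R

  prodFin : ∀ {m} → (Fin m → Carrier) → Carrier
  prodFin {zero}  f = 1#
  prodFin {suc m} f = f Fin.zero * prodFin (λ k → f (Fin.suc k))

  sumList : List Carrier → Carrier
  sumList = foldr _+_ 0#

  -- square matrices indexed by compositions of n (boolean words of length m = n-1)
  Matrix : ℕ → Set c
  Matrix m = Vec Bool m → Vec Bool m → Carrier

  _⊗_ : ∀ {m} → Matrix m → Matrix m → Matrix m
  (A ⊗ B) I J = sumList (map (λ L → A I L * B L J) (allWords _))

  idMatrix : ∀ {m} → Matrix m
  idMatrix I J = if does (VecP.≡-dec BoolP._≟_ I J) then 1# else 0#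

  _≈M_ : ∀ {m} → Matrix m → Matrix m → Set ℓ
  A ≈M B = ∀ I J → A I J ≈ B I J

  IsInverseOf : ∀ {m} → Matrix m → Matrix m → Set ℓ
  IsInverseOf M A = ((A ⊗ M) ≈M idMatrix) × ((M ⊗ A) ≈M idMatrix)

  specialize : (Word → Carrier) → (Word → Carrier)
  specialize y w = if endsIn1 w then 1# else y w

  yLow : (Word → Carrier) → ∀ {m} → Vec Bool m → Fin m → Carrier
  yLow y I k = y (prefixW I k)

  yUp : (Word → Carrier) → ∀ {m} → Vec Bool m → Fin m → Carrier
  yUp y I k = y (flipW I k)

  -- (K_n)_{IJ} = ∏_{d ∈ Des(J)} y_d(I)
  kostka : (Word → Carrier) → ∀ {m} → Matrix m
  kostka y I J = prodFin (λ k → if lookup J k then yLow y I k else 1#)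

  kostka' : (Word → Carrier) → ∀ {m} → Matrix m
  kostka' y = kostka (specialize y)

  denom : (Word → Carrier) → ∀ {m} → Vec Bool m → Fin m → Carrier
  denom y J k = yLow (specialize y) J k - yUp (specialize y) J k

  -- s_IJ = ∏_k (y_k(I) - y'^k(J)) / (y'_k(J) - y'^k(J)),
  -- where δ J k is the (given) inverse of the denominator y'_k(J) - y'^k(J)
  sEntry : (Word → Carrier) → ∀ {m} → (Vec Bool m → Fin m → Carrier) → Matrix m
  sEntry y δ I J = prodFin (λ k → (yLow y I k - yUp (specialize y) J k) * δ J k)

-- Both K and the candidate inverse factor along the first letter of a word:
-- K_y(aI, cL) = (if c then y_a else 1) · K_{y∘(a∷)}(I, L), so an entry of a
-- product of such matrices is a 2×2 product over the first letter times a
-- product of the same shape on words one letter shorter.  The candidate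
-- inverse of K_p is built letter by letter from the inverse
-- (1/(p_0 − p_1)) [[−p_1, p_0], [1, −1]] of the 2×2 Kostka matrix
-- [[1, p_0], [1, p_1]]; by induction on the length, K_y · K_p⁻¹ is the
-- matrix with entries ∏_k (y_k(I) − p^k(J)) / (p_k(J) − p^k(J)).  For y = p
-- this is the identity, and for p = y′ it is lower triangular: at the first
-- position where I has 0 and J has 1 the numerator is y_w − y′_w for a word w
-- ending in 0, which vanishes.
module Submission where

open import Level using (Level)
open import Data.Bool using (Bool; true; false; not; if_then_else_)
open import Data.Nat using (ℕ; zero; suc; _≤_; _∸_)
open import Data.Fin using (Fin)
import Data.Fin as Fin
open import Data.List using (List; []; _∷_; _++_; [_]; _∷ʳ_; map)
import Data.List.Properties as List
open import Data.Vec using (Vec; []; _∷_; replicate)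
open import Data.Product using (Σ; _×_; _,_)
open import Algebra.Bundles using (CommutativeRing)
import Relation.Binary.PropositionalEquality as P
import Relation.Binary.Reasoning.Setoid as SetoidReasoning
import Defs as D
open import Defs using (Word; endsIn1; allWords; _<ₗ_; here; there; yLow; yUp; specialize)

endsIn1-∷ʳ-false : ∀ w → endsIn1 (w ∷ʳ false) P.≡ false
endsIn1-∷ʳ-false []          = P.refl
endsIn1-∷ʳ-false (_ ∷ [])    = P.refl
endsIn1-∷ʳ-false (_ ∷ b ∷ w) = endsIn1-∷ʳ-false (b ∷ w)

module KostkaInverse {c ℓ} (R : CommutativeRing c ℓ) where
  open CommutativeRing R
  open SetoidReasoning setoid
  open import Algebra.Properties.Ring ring
    using (-‿distribˡ-*; -‿distribʳ-*; [y-z]x≈yx-zx; -‿involutive; ⁻¹-anti-homo‿-; x≈y⇒x∙y⁻¹≈ε)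
  open import Algebra.Properties.CommutativeSemigroup *-commutativeSemigroup
    using (interchange; x∙yz≈yx∙z; xy∙z≈xz∙y)

  private
    Matrix : ℕ → Set c
    Matrix = D.Matrix R

    sumList : List Carrier → Carrier
    sumList = D.sumList R

    _⊗_ : ∀ {m} → Matrix m → Matrix m → Matrix m
    _⊗_ = D._⊗_ R

    _≈M_ : ∀ {m} → Matrix m → Matrix m → Set ℓ
    _≈M_ = D._≈M_ R

    idMatrix : ∀ {m} → Matrix m
    idMatrix = D.idMatrix R

    kostka : (Word → Carrier) → ∀ {m} → Matrix m
    kostka = D.kostka R

  Assignment : Set c
  Assignment = Word → Carrier

  Inverses : ℕ → Set c
  Inverses m = Vec Bool m → Fin m → Carrier

  InvertsDenominators : ∀ {m} → Assignment → Inverses m → Set ℓ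
  InvertsDenominators p δ = ∀ J k → (yLow R p J k - yUp R p J k) * δ J k ≈ 1#

  below : Bool → Assignment → Assignment
  below b y w = y (b ∷ w)

  belowInverses : ∀ {m} → Bool → Inverses (suc m) → Inverses m
  belowInverses b δ J k = δ (b ∷ J) (Fin.suc k)

  invertsDenominators-below : ∀ {m} p (δ : Inverses (suc m)) → InvertsDenominators p δ →
                              ∀ b → InvertsDenominators (below b p) (belowInverses b δ)
  invertsDenominators-below p δ H b J k = H (b ∷ J) (Fin.suc k)

  -- The paper's S is sMatrix y y′ δ; δ J k is meant to invert p_k(J) − p^k(J).
  sMatrix : ∀ {m} → Assignment → Assignment → Inverses m → Matrix m
  sMatrix y p δ I J = D.prodFin R (λ k → (yLow R y I k - yUp R p J k) * δ J k)

  inverse-unique : ∀ {x d d′} → x * d ≈ 1# → x * d′ ≈ 1# → d ≈ d′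
  inverse-unique {x} {d} {d′} xd≈1 xd′≈1 = begin
    d            ≈⟨ *-identityʳ d ⟨
    d * 1#       ≈⟨ *-congˡ xd′≈1 ⟨
    d * (x * d′) ≈⟨ x∙yz≈yx∙z d x d′ ⟩
    (x * d) * d′ ≈⟨ *-congʳ xd≈1 ⟩
    1# * d′      ≈⟨ *-identityˡ d′ ⟩
    d′           ∎

  sumList-++ : ∀ xs ys → sumList (xs ++ ys) ≈ sumList xs + sumList ys
  sumList-++ []       ys = sym (+-identityˡ _)
  sumList-++ (x ∷ xs) ys = trans (+-congˡ (sumList-++ xs ys)) (sym (+-assoc _ _ _))

  sumList-map-cong : ∀ {A : Set} (W : List A) {f g : A → Carrier} → (∀ L → f L ≈ g L) →
                     sumList (map f W) ≈ sumList (map g W)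
  sumList-map-cong []      f≈g = refl
  sumList-map-cong (L ∷ W) f≈g = +-cong (f≈g L) (sumList-map-cong W f≈g)

  sumList-map-*ˡ : ∀ {A : Set} (W : List A) x (f : A → Carrier) →
                   sumList (map (λ L → x * f L) W) ≈ x * sumList (map f W)
  sumList-map-*ˡ []      x f = sym (zeroʳ x)
  sumList-map-*ˡ (L ∷ W) x f = trans (+-congˡ (sumList-map-*ˡ W x f)) (sym (distribˡ x _ _))

  dot : ∀ {m} → (Vec Bool m → Carrier) → (Vec Bool m → Carrier) → Carrier
  dot x z = sumList (map (λ L → x L * z L) (allWords _))

  dot-∷ : ∀ {m} (x z : Vec Bool (suc m) → Carrier) →
          dot x z ≈ dot (λ L → x (false ∷ L)) (λ L → z (false ∷ L))
                  + dot (λ L → x (true ∷ L)) (λ L → z (true ∷ L))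
  dot-∷ {m} x z = begin
    sumList (map f (map (false ∷_) W ++ map (true ∷_) W))
      ≡⟨ P.cong sumList (List.map-++ f (map (false ∷_) W) _) ⟩
    sumList (map f (map (false ∷_) W) ++ map f (map (true ∷_) W))
      ≈⟨ sumList-++ (map f (map (false ∷_) W)) _ ⟩
    sumList (map f (map (false ∷_) W)) + sumList (map f (map (true ∷_) W))
      ≡⟨ P.cong₂ (λ u v → sumList u + sumList v) (P.sym (List.map-∘ W)) (P.sym (List.map-∘ W)) ⟩
    dot (λ L → x (false ∷ L)) (λ L → z (false ∷ L)) + dot (λ L → x (true ∷ L)) (λ L → z (true ∷ L)) ∎
    where
    W : List (Vec Bool m)
    W = allWords m
    f : Vec Bool (suc m) → Carrier
    f L = x L * z L

  dot-scale : ∀ {m} α β (x z : Vec Bool m → Carrier) →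
              dot (λ L → α * x L) (λ L → β * z L) ≈ α * β * dot x z
  dot-scale {m} α β x z = trans (sumList-map-cong (allWords m) (λ L → interchange α (x L) β (z L)))
                                (sumList-map-*ˡ (allWords m) (α * β) (λ L → x L * z L))

  ⊗-[] : (A B : Matrix 0) → (A ⊗ B) [] [] ≈ A [] [] * B [] []
  ⊗-[] A B = +-identityʳ _

  ⊗-blocks : ∀ {m} (A B : Matrix (suc m)) (α β : Bool → Carrier) (A′ B′ : Bool → Matrix m) {a b I J} →
             (∀ c L → A (a ∷ I) (c ∷ L) ≈ α c * A′ c I L) →
             (∀ c L → B (c ∷ L) (b ∷ J) ≈ β c * B′ c L J) →
             (A ⊗ B) (a ∷ I) (b ∷ J)
               ≈ α false * β false * (A′ false ⊗ B′ false) I J + α true * β true * (A′ true ⊗ B′ true) I J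
  ⊗-blocks A B α β A′ B′ {a} {b} {I} {J} hA hB =
    trans (dot-∷ (A (a ∷ I)) (λ L → B L (b ∷ J))) (+-cong (block false) (block true))
    where
    block : ∀ c → dot (λ L → A (a ∷ I) (c ∷ L)) (λ L → B (c ∷ L) (b ∷ J))
                    ≈ α c * β c * (A′ c ⊗ B′ c) I J
    block c = trans (sumList-map-cong (allWords _) (λ L → *-cong (hA c L) (hB c L)))
                    (dot-scale (α c) (β c) (A′ c I) (λ L → B′ c L J))

  kronecker : Bool → Bool → Carrier
  kronecker true  true  = 1#
  kronecker false false = 1#
  kronecker true  false = 0#
  kronecker false true  = 0#

  idMatrix-∷ : ∀ {m} a b (I J : Vec Bool m) → kronecker a b * idMatrix I J ≈ idMatrix (a ∷ I) (b ∷ J)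
  idMatrix-∷ true  true  I J = *-identityˡ _
  idMatrix-∷ false false I J = *-identityˡ _
  idMatrix-∷ true  false I J = zeroˡ _
  idMatrix-∷ false true  I J = zeroˡ _

  onLetter : Assignment → Bool → Carrier
  onLetter y b = y [ b ]

  kostka₂ : (Bool → Carrier) → Bool → Bool → Carrier
  kostka₂ q a c = if c then q a else 1#

  -- The inverse of kostka₂ q when d b inverts q b − q (not b).
  inverse₂ : (Bool → Carrier) → (Bool → Carrier) → Bool → Bool → Carrier
  inverse₂ q d true  c = d c
  inverse₂ q d false c = - q (not c) * d c

  kostka₂-inverse₂ : ∀ (Y q d : Bool → Carrier) a b →
                     kostka₂ Y a false * inverse₂ q d false b + kostka₂ Y a true * inverse₂ q d true b
                       ≈ (Y a - q (not b)) * d b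
  kostka₂-inverse₂ Y q d a b = begin
    1# * (- q (not b) * d b) + Y a * d b ≈⟨ +-congʳ (*-identityˡ _) ⟩
    - q (not b) * d b + Y a * d b        ≈⟨ distribʳ (d b) _ _ ⟨
    (- q (not b) + Y a) * d b            ≈⟨ *-congʳ (+-comm _ _) ⟩
    (Y a - q (not b)) * d b              ∎

  module TwoByTwo (q d : Bool → Carrier) (d-inverts : ∀ b → (q b - q (not b)) * d b ≈ 1#) where
    private
      q₀ q₁ d₀ d₁ : Carrier
      q₀ = q false
      q₁ = q true
      d₀ = d false
      d₁ = d true

    d₁≈-d₀ : d₁ ≈ - d₀
    d₁≈-d₀ = inverse-unique (d-inverts true) (begin
      (q₁ - q₀) * - d₀   ≈⟨ -‿distribʳ-* _ d₀ ⟨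
      - ((q₁ - q₀) * d₀) ≈⟨ -‿distribˡ-* _ d₀ ⟩
      - (q₁ - q₀) * d₀   ≈⟨ *-congʳ (⁻¹-anti-homo‿- q₁ q₀) ⟩
      (q₀ - q₁) * d₀     ≈⟨ d-inverts false ⟩
      1#                 ∎)

    ud₀+vd₁≈[u-v]d₀ : ∀ u v → u * d₀ + v * d₁ ≈ (u - v) * d₀
    ud₀+vd₁≈[u-v]d₀ u v = begin
      u * d₀ + v * d₁   ≈⟨ +-congˡ (*-congˡ d₁≈-d₀) ⟩
      u * d₀ + v * - d₀ ≈⟨ +-congˡ (-‿distribʳ-* v d₀) ⟨
      u * d₀ - v * d₀   ≈⟨ [y-z]x≈yx-zx d₀ u v ⟨
      (u - v) * d₀      ∎

    inverse₂-kostka₂ : ∀ a b → inverse₂ q d a false * kostka₂ q false b + inverse₂ q d a true * kostka₂ q true b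
                                 ≈ kronecker a b
    inverse₂-kostka₂ true false = begin
      d₀ * 1# + d₁ * 1# ≈⟨ +-cong (*-comm d₀ 1#) (*-comm d₁ 1#) ⟩
      1# * d₀ + 1# * d₁ ≈⟨ ud₀+vd₁≈[u-v]d₀ 1# 1# ⟩
      (1# - 1#) * d₀    ≈⟨ *-congʳ (-‿inverseʳ 1#) ⟩
      0# * d₀           ≈⟨ zeroˡ d₀ ⟩
      0#                ∎
    inverse₂-kostka₂ true true = begin
      d₀ * q₀ + d₁ * q₁ ≈⟨ +-cong (*-comm d₀ q₀) (*-comm d₁ q₁) ⟩
      q₀ * d₀ + q₁ * d₁ ≈⟨ ud₀+vd₁≈[u-v]d₀ q₀ q₁ ⟩
      (q₀ - q₁) * d₀    ≈⟨ d-inverts false ⟩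
      1#                ∎
    inverse₂-kostka₂ false false = begin
      - q₁ * d₀ * 1# + - q₀ * d₁ * 1# ≈⟨ +-cong (*-identityʳ _) (*-identityʳ _) ⟩
      - q₁ * d₀ + - q₀ * d₁           ≈⟨ ud₀+vd₁≈[u-v]d₀ (- q₁) (- q₀) ⟩
      (- q₁ - - q₀) * d₀              ≈⟨ *-congʳ (trans (+-congˡ (-‿involutive q₀)) (+-comm _ _)) ⟩
      (q₀ - q₁) * d₀                  ≈⟨ d-inverts false ⟩
      1#                              ∎
    inverse₂-kostka₂ false true = begin
      - q₁ * d₀ * q₀ + - q₀ * d₁ * q₁ ≈⟨ +-cong (xy∙z≈xz∙y _ d₀ q₀) (xy∙z≈xz∙y _ d₁ q₁) ⟩
      - q₁ * q₀ * d₀ + - q₀ * q₁ * d₁ ≈⟨ ud₀+vd₁≈[u-v]d₀ _ _ ⟩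
      (- q₁ * q₀ - - q₀ * q₁) * d₀    ≈⟨ *-congʳ (x≈y⇒x∙y⁻¹≈ε -q₁q₀≈-q₀q₁) ⟩
      0# * d₀                         ≈⟨ zeroˡ d₀ ⟩
      0#                              ∎
      where
      -q₁q₀≈-q₀q₁ : - q₁ * q₀ ≈ - q₀ * q₁
      -q₁q₀≈-q₀q₁ = begin
        - q₁ * q₀   ≈⟨ -‿distribˡ-* q₁ q₀ ⟨
        - (q₁ * q₀) ≈⟨ -‿cong (*-comm q₁ q₀) ⟩
        - (q₀ * q₁) ≈⟨ -‿distribˡ-* q₀ q₁ ⟩
        - q₀ * q₁   ∎

  -- The leading denominator p_1(J) − p^1(J) depends only on the first letter
  -- of J, so any J (here 0⋯0) supplies its inverse.
  pivot : ∀ {m} → Inverses (suc m) → Bool → Carrier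
  pivot δ b = δ (b ∷ replicate _ false) Fin.zero

  pivot-inverts : ∀ {m} p (δ : Inverses (suc m)) → InvertsDenominators p δ →
                  ∀ b → (onLetter p b - onLetter p (not b)) * pivot δ b ≈ 1#
  pivot-inverts p δ H b = H (b ∷ replicate _ false) Fin.zero

  pivot-unique : ∀ {m} p (δ : Inverses (suc m)) → InvertsDenominators p δ →
                 ∀ b J → pivot δ b ≈ δ (b ∷ J) Fin.zero
  pivot-unique p δ H b J = inverse-unique (H (b ∷ replicate _ false) Fin.zero) (H (b ∷ J) Fin.zero)

  kostka⁻¹ : ∀ {m} → Assignment → Inverses m → Matrix m
  kostka⁻¹ {zero}  p δ []      []      = 1#
  kostka⁻¹ {suc m} p δ (a ∷ I) (b ∷ J) =
    inverse₂ (onLetter p) (pivot δ) a b * kostka⁻¹ (below b p) (belowInverses b δ) I J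

  kostka-⊗-kostka⁻¹ : ∀ {m} y p (δ : Inverses m) → InvertsDenominators p δ →
                      (kostka y ⊗ kostka⁻¹ p δ) ≈M sMatrix y p δ
  kostka-⊗-kostka⁻¹ {zero}  y p δ H [] [] = trans (⊗-[] (kostka y) (kostka⁻¹ p δ)) (*-identityˡ 1#)
  kostka-⊗-kostka⁻¹ {suc m} y p δ H (a ∷ I) (b ∷ J) = begin
    (kostka y ⊗ kostka⁻¹ p δ) (a ∷ I) (b ∷ J)
      ≈⟨ ⊗-blocks (kostka y) (kostka⁻¹ p δ) α β (λ _ → kostka (below a y)) (λ _ → kostka⁻¹ pb δb)
                  (λ _ _ → refl) (λ _ _ → refl) ⟩
    α false * β false * (kostka (below a y) ⊗ kostka⁻¹ pb δb) I J
      + α true * β true * (kostka (below a y) ⊗ kostka⁻¹ pb δb) I J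
      ≈⟨ +-cong (*-congˡ IH) (*-congˡ IH) ⟩
    α false * β false * S + α true * β true * S
      ≈⟨ distribʳ S _ _ ⟨
    (α false * β false + α true * β true) * S
      ≈⟨ *-congʳ (kostka₂-inverse₂ (onLetter y) (onLetter p) (pivot δ) a b) ⟩
    (y [ a ] - p [ not b ]) * pivot δ b * S
      ≈⟨ *-congʳ (*-congˡ (pivot-unique p δ H b J)) ⟩
    sMatrix y p δ (a ∷ I) (b ∷ J) ∎
    where
    pb : Assignment
    pb = below b p
    δb : Inverses m
    δb = belowInverses b δ
    α β : Bool → Carrier
    α = kostka₂ (onLetter y) a
    β c = inverse₂ (onLetter p) (pivot δ) c b
    S : Carrier
    S = sMatrix (below a y) pb δb I J
    IH : (kostka (below a y) ⊗ kostka⁻¹ pb δb) I J ≈ S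
    IH = kostka-⊗-kostka⁻¹ (below a y) pb δb (invertsDenominators-below p δ H b) I J

  kostka⁻¹-⊗-kostka : ∀ {m} p (δ : Inverses m) → InvertsDenominators p δ →
                      (kostka⁻¹ p δ ⊗ kostka p) ≈M idMatrix
  kostka⁻¹-⊗-kostka {zero}  p δ H [] [] = trans (⊗-[] (kostka⁻¹ p δ) (kostka p)) (*-identityˡ 1#)
  kostka⁻¹-⊗-kostka {suc m} p δ H (a ∷ I) (b ∷ J) = begin
    (kostka⁻¹ p δ ⊗ kostka p) (a ∷ I) (b ∷ J)
      ≈⟨ ⊗-blocks (kostka⁻¹ p δ) (kostka p) α β A′ B′ {a} {b} {I} {J} (λ _ _ → refl) (λ _ _ → refl) ⟩
    α false * β false * (A′ false ⊗ B′ false) I J + α true * β true * (A′ true ⊗ B′ true) I J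
      ≈⟨ +-cong (*-congˡ (IH false)) (*-congˡ (IH true)) ⟩
    α false * β false * idMatrix I J + α true * β true * idMatrix I J
      ≈⟨ distribʳ (idMatrix I J) _ _ ⟨
    (α false * β false + α true * β true) * idMatrix I J
      ≈⟨ *-congʳ (TwoByTwo.inverse₂-kostka₂ (onLetter p) (pivot δ) (pivot-inverts p δ H) a b) ⟩
    kronecker a b * idMatrix I J
      ≈⟨ idMatrix-∷ a b I J ⟩
    idMatrix (a ∷ I) (b ∷ J) ∎
    where
    α β : Bool → Carrier
    α = inverse₂ (onLetter p) (pivot δ) a
    β c = kostka₂ (onLetter p) c b
    A′ B′ : Bool → Matrix m
    A′ c = kostka⁻¹ (below c p) (belowInverses c δ)
    B′ c = kostka (below c p)
    IH : ∀ c → (A′ c ⊗ B′ c) I J ≈ idMatrix I J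
    IH c = kostka⁻¹-⊗-kostka (below c p) (belowInverses c δ) (invertsDenominators-below p δ H c) I J

  sMatrix-∷-diagonal : ∀ {m} p (δ : Inverses (suc m)) → InvertsDenominators p δ → ∀ b I J →
                       sMatrix p p δ (b ∷ I) (b ∷ J) ≈ sMatrix (below b p) (below b p) (belowInverses b δ) I J
  sMatrix-∷-diagonal p δ H b I J = trans (*-congʳ (H (b ∷ J) Fin.zero)) (*-identityˡ _)

  sMatrix-∷-vanishes : ∀ {m} y p (δ : Inverses (suc m)) a b I J → y [ a ] ≈ p [ not b ] →
                       sMatrix y p δ (a ∷ I) (b ∷ J) ≈ 0#
  sMatrix-∷-vanishes y p δ a b I J ya≈pb =
    trans (*-congʳ (trans (*-congʳ (x≈y⇒x∙y⁻¹≈ε ya≈pb)) (zeroˡ _))) (zeroˡ _)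

  sMatrix-self : ∀ {m} p (δ : Inverses m) → InvertsDenominators p δ → sMatrix p p δ ≈M idMatrix
  sMatrix-self {zero}  p δ H [] [] = refl
  sMatrix-self {suc m} p δ H (false ∷ I) (false ∷ J) =
    trans (sMatrix-∷-diagonal p δ H false I J)
          (sMatrix-self (below false p) (belowInverses false δ) (invertsDenominators-below p δ H false) I J)
  sMatrix-self {suc m} p δ H (true ∷ I) (true ∷ J) =
    trans (sMatrix-∷-diagonal p δ H true I J)
          (sMatrix-self (below true p) (belowInverses true δ) (invertsDenominators-below p δ H true) I J)
  sMatrix-self {suc m} p δ H (false ∷ I) (true ∷ J) = sMatrix-∷-vanishes p p δ false true I J refl
  sMatrix-self {suc m} p δ H (true ∷ I) (false ∷ J) = sMatrix-∷-vanishes p p δ true false I J refl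

  sMatrix-lowerTriangular : ∀ {m} y p (δ : Inverses m) → (∀ w → y (w ∷ʳ false) ≈ p (w ∷ʳ false)) →
                            ∀ I J → I <ₗ J → sMatrix y p δ I J ≈ 0#
  sMatrix-lowerTriangular y p δ y≈p (false ∷ I) (true ∷ J) here =
    sMatrix-∷-vanishes y p δ false true I J (y≈p [])
  sMatrix-lowerTriangular y p δ y≈p (b ∷ I) (.b ∷ J) (there I<J) =
    trans (*-congˡ (sMatrix-lowerTriangular (below b y) (below b p) (belowInverses b δ) (λ w → y≈p (b ∷ w)) I J I<J))
          (zeroʳ _)

  specialize-∷ʳ-false : ∀ y w → y (w ∷ʳ false) ≈ specialize R y (w ∷ʳ false)
  specialize-∷ʳ-false y w rewrite endsIn1-∷ʳ-false w = refl

open import Defs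

mainTheorem5 : ∀ {c ℓ : Level} (R : CommutativeRing c ℓ) (n : ℕ) → 1 ≤ n →
    (y : Word → CommutativeRing.Carrier R) →
    (δ : Vec Bool (n ∸ 1) → Fin (n ∸ 1) → CommutativeRing.Carrier R) →
    (∀ J k → CommutativeRing._≈_ R (CommutativeRing._*_ R (denom R y J k) (δ J k)) (CommutativeRing.1# R)) →
    Σ (Matrix R (n ∸ 1)) (λ M →
      IsInverseOf R M (kostka' R y)
      × _≈M_ R (_⊗_ R (kostka R y) M) (sEntry R y δ)
      × (∀ I J → I <ₗ J → CommutativeRing._≈_ R (_⊗_ R (kostka R y) M I J) (CommutativeRing.0# R)))
mainTheorem5 R n _ y δ H =
  kostka⁻¹ y′ δ ,
  ((λ I J → trans (kostka-⊗-kostka⁻¹ y′ y′ δ H I J) (sMatrix-self y′ δ H I J)) , kostka⁻¹-⊗-kostka y′ δ H) ,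
  kostka-⊗-kostka⁻¹ y y′ δ H ,
  λ I J I<J → trans (kostka-⊗-kostka⁻¹ y y′ δ H I J)
                    (sMatrix-lowerTriangular y y′ δ (specialize-∷ʳ-false y) I J I<J)
  where
  open CommutativeRing R using (trans)
  open KostkaInverse R using (kostka⁻¹; kostka-⊗-kostka⁻¹; kostka⁻¹-⊗-kostka; sMatrix-self;
                              sMatrix-lowerTriangular; specialize-∷ʳ-false)
  y′ : Word → CommutativeRing.Carrier R
  y′ = specialize R y
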